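{- Let $M \ge 2$ and $N \ge 1$ be integers, and let $b(n) = \mathcal{B}_{M,N}(n) \bmod M$ for $n \ge 0$. The sequence $(b(n))_{n\ge 0}$ is ultimately periodic if and only if every prime factor of $M$ is also a prime factor of $N$ (equivalently, $\operatorname{rad}(M) \mid \operatorname{rad}(N)$).
   Context: For integers $M\ge 2$, $N \ge 1$ and $n\ge 0$ with base-$M$ expansion $n=\sum_{i\ge 0} d_i(n) M^i$, $d_i(n)\in\{0,\dots,M-1\}$, the base-shifting map is $\mathcal{B}_{M,N}(n) := \sum_{i\ge 0} d_i(n) N^i$ (same digit string, read in base $N$). $\operatorname{rad}(k)$ denotes the product of the distinct prime factors of $k$. A sequence $(b(n))$ is ultimately periodic if there exist $P>0$ and $n_0$ with $b(n+P)=b(n)$ for all $n\ge n_0$. -}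

module Defs where

open import Data.Nat using (ℕ; zero; suc; _+_; _*_; _≤_; _>_; NonZero)
open import Data.Nat.DivMod using (_/_; _%_)
open import Data.Product using (Σ; ∃; _×_)
open import Relation.Binary.PropositionalEquality using (_≡_)

-- Auxiliary with fuel: reads the base-M digits of n (least significant first)
-- as a base-N numeral. Fuel f ≥ number of base-M digits suffices; fuel n always suffices.
baseShiftFuel : (M N : ℕ) → .{{_ : NonZero M}} → ℕ → ℕ → ℕ
baseShiftFuel M N zero    n = 0
baseShiftFuel M N (suc f) n = n % M + N * baseShiftFuel M N f (n / M)

baseShift : (M N : ℕ) → .{{_ : NonZero M}} → ℕ → ℕ
baseShift M N n = baseShiftFuel M N n n

bSeq : (M N : ℕ) → .{{_ : NonZero M}} → ℕ → ℕ
bSeq M N n = baseShift M N n % M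

UltimatelyPeriodic : (ℕ → ℕ) → Set
UltimatelyPeriodic b = Σ ℕ λ P → Σ ℕ λ n₀ → P > 0 × (∀ n → n₀ ≤ n → b (n + P) ≡ b n)

-- Reading base-M digits in base N is additive on digit-disjoint sums:
-- B(r + Mᵏ c) = B(r) + Nᵏ B(c) for r < Mᵏ.  Hence if M ∣ Nᵏ, adding Mᵏ changes
-- B(n) only by a multiple of M and b has period Mᵏ.  Conversely, a period P
-- gives a < a' with Mᵃ ≡ Mᵃ' (mod P), so b(s + Mᵃ) = b(s + Mᵃ') for large s.
-- Taking s = Mᵃ y for two two-digit choices of y, this forces Nᵃ⁺¹ ≡ 0 (mod M),
-- i.e. every prime factor of M divides N.
module Submission where

open import Defs
open import Data.Nat using (ℕ; _≥_; NonZero)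
open import Data.Nat.Divisibility using (_∣_)
open import Data.Nat.Primality using (Prime)
open import Function.Bundles using (_⇔_)

open import Data.Nat
open import Data.Nat.Properties
open import Data.Nat.DivMod
open import Data.Nat.Divisibility
open import Data.Nat.Primality
open import Data.Nat.Primality.Factorisation
open import Data.Nat.ListAction using (product)
open import Data.Nat.Tactic.RingSolver using (solve-∀)
open import Data.Fin using (toℕ; fromℕ<)
open import Data.Fin.Properties using (pigeonhole; toℕ-fromℕ<)
open import Data.List using ([]; _∷_; length)
open import Data.List.Relation.Unary.All using (All; []; _∷_)
open import Data.Product using (_,_; ∃-syntax; ∃₂; _×_)
open import Data.Sum using (inj₁; inj₂)
open import Data.Empty using (⊥-elim)
open import Function.Bundles using (mk⇔)
open import Relation.Binary.PropositionalEquality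

module Congruence (m : ℕ) .{{_ : NonZero m}} where

  infix 4 _≋_
  _≋_ : ℕ → ℕ → Set
  x ≋ y = x % m ≡ y % m

  ≋-resp : ∀ {x x′ y y′} → x ≡ x′ → y ≡ y′ → x ≋ y → x′ ≋ y′
  ≋-resp refl refl x≋y = x≋y

  ≋-+-congˡ : ∀ s {x y} → x ≋ y → s + x ≋ s + y
  ≋-+-congˡ s {x} {y} x≋y = begin
    (s + x) % m          ≡⟨ %-distribˡ-+ s x m ⟩
    (s % m + x % m) % m  ≡⟨ cong (λ z → (s % m + z) % m) x≋y ⟩
    (s % m + y % m) % m  ≡⟨ %-distribˡ-+ s y m ⟨
    (s + y) % m          ∎
    where open ≡-Reasoning

  -- Adding (pred m) c to both sides turns the common summand c into m c.
  ≋-+-cancelʳ : ∀ x y c → x + c ≋ y + c → x ≋ y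
  ≋-+-cancelʳ x y c x+c≋y+c = begin
    x % m                      ≡⟨ %-remove-+ʳ x (m∣m*n c) ⟨
    (x + m * c) % m            ≡⟨ cong (_% m) (absorb x) ⟨
    (pred m * c + (x + c)) % m ≡⟨ ≋-+-congˡ (pred m * c) x+c≋y+c ⟩
    (pred m * c + (y + c)) % m ≡⟨ cong (_% m) (absorb y) ⟩
    (y + m * c) % m            ≡⟨ %-remove-+ʳ y (m∣m*n c) ⟩
    y % m                      ∎
    where
    open ≡-Reasoning
    absorb : ∀ z → pred m * c + (z + c) ≡ z + m * c
    absorb z = trans (ring (pred m) c z) (cong (λ k → z + k * c) (suc-pred m))
      where
      ring : ∀ p c z → p * c + (z + c) ≡ z + suc p * c
      ring = solve-∀

module Periodic {A : Set} {b : ℕ → A} {P n₀ : ℕ}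
                (period : ∀ n → n₀ ≤ n → b (n + P) ≡ b n) where

  period-* : ∀ q n → n₀ ≤ n → b (n + q * P) ≡ b n
  period-* zero    n _    = cong b (+-identityʳ n)
  period-* (suc q) n n₀≤n = begin
    b (n + (P + q * P)) ≡⟨ cong b (ring n P (q * P)) ⟩
    b (n + q * P + P)   ≡⟨ period (n + q * P) (≤-trans n₀≤n (m≤m+n n _)) ⟩
    b (n + q * P)       ≡⟨ period-* q n n₀≤n ⟩
    b n                 ∎
    where
    open ≡-Reasoning
    ring : ∀ n p r → n + (p + r) ≡ n + r + p
    ring = solve-∀

  period-% : .{{_ : NonZero P}} → ∀ x y → x % P ≡ y % P → ∀ n → n₀ ≤ n → b (n + x) ≡ b (n + y)
  period-% x y x%P≡y%P n n₀≤n = begin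
    b (n + x)                     ≡⟨ cong b (split x) ⟩
    b (n + x % P + x / P * P)     ≡⟨ period-* (x / P) _ (≤-trans n₀≤n (m≤m+n n _)) ⟩
    b (n + x % P)                 ≡⟨ cong (λ r → b (n + r)) x%P≡y%P ⟩
    b (n + y % P)                 ≡⟨ period-* (y / P) _ (≤-trans n₀≤n (m≤m+n n _)) ⟨
    b (n + y % P + y / P * P)     ≡⟨ cong b (split y) ⟨
    b (n + y)                     ∎
    where
    open ≡-Reasoning
    split : ∀ z → n + z ≡ n + z % P + z / P * P
    split z = trans (cong (n +_) (m≡m%n+[m/n]*n z P)) (sym (+-assoc n _ _))

%-collision : ∀ P .{{_ : NonZero P}} (f : ℕ → ℕ) n₀ →
              ∃₂ λ a t → n₀ ≤ a × f (a + suc t) % P ≡ f a % P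
%-collision P f n₀ with pigeonhole (n<1+n P) (λ i → fromℕ< (m%n<n (f (n₀ + toℕ i)) P))
... | i , j , i<j , fᵢ≡fⱼ with m≤n⇒∃[o]m+o≡n i<j
... | t , 1+i+t≡j = n₀ + toℕ i , t , m≤m+n n₀ (toℕ i) , collision
  where
  open ≡-Reasoning
  index : n₀ + toℕ i + suc t ≡ n₀ + toℕ j
  index = trans (+-assoc n₀ (toℕ i) (suc t)) (cong (n₀ +_) (trans (+-suc (toℕ i) t) 1+i+t≡j))
  collision : f (n₀ + toℕ i + suc t) % P ≡ f (n₀ + toℕ i) % P
  collision = begin
    f (n₀ + toℕ i + suc t) % P ≡⟨ cong (λ k → f k % P) index ⟩
    f (n₀ + toℕ j) % P         ≡⟨ toℕ-fromℕ< _ ⟨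
    toℕ (fromℕ< _)             ≡⟨ cong toℕ fᵢ≡fⱼ ⟨
    toℕ (fromℕ< _)             ≡⟨ toℕ-fromℕ< _ ⟩
    f (n₀ + toℕ i) % P         ∎

n<m^n : ∀ {m} → 1 < m → ∀ n → n < m ^ n
n<m^n 1<m zero    = s≤s z≤n
n<m^n {m} 1<m (suc n) = begin
  2 + n              ≤⟨ +-mono-≤ (m^n>0 m n) (n<m^n 1<m n) ⟩
  m ^ n + m ^ n      ≡⟨ cong (m ^ n +_) (+-identityʳ (m ^ n)) ⟨
  2 * m ^ n          ≤⟨ *-monoˡ-≤ (m ^ n) 1<m ⟩
  m * m ^ n          ∎
  where
  open ≤-Reasoning
  instance _ = >-nonZero (<-trans z<s 1<m)

module BaseShift (M N : ℕ) .{{_ : NonZero M}} (1<M : 1 < M) where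

  open Congruence M

  B : ℕ → ℕ
  B = baseShift M N

  private
    0%M≡0 : 0 % M ≡ 0
    0%M≡0 = m<n⇒m%n≡m (>-nonZero⁻¹ M)

    n≤1+f⇒n/M≤f : ∀ n f → n ≤ suc f → n / M ≤ f
    n≤1+f⇒n/M≤f zero    f _   = subst (_≤ f) (sym (0/n≡0 M)) z≤n
    n≤1+f⇒n/M≤f (suc n) f n≤f = ≤-pred (≤-trans (m/n<m (suc n) M 1<M) n≤f)

  baseShiftFuel-0 : ∀ f → baseShiftFuel M N f 0 ≡ 0
  baseShiftFuel-0 zero = refl
  baseShiftFuel-0 (suc f) = begin
    0 % M + N * baseShiftFuel M N f (0 / M) ≡⟨ cong₂ (λ r q → r + N * baseShiftFuel M N f q) 0%M≡0 (0/n≡0 M) ⟩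
    N * baseShiftFuel M N f 0               ≡⟨ cong (N *_) (baseShiftFuel-0 f) ⟩
    N * 0                                   ≡⟨ *-zeroʳ N ⟩
    0                                       ∎
    where open ≡-Reasoning

  baseShiftFuel-irrelevant : ∀ n f g → n ≤ f → n ≤ g →
                             baseShiftFuel M N f n ≡ baseShiftFuel M N g n
  baseShiftFuel-irrelevant zero f g _ _ = trans (baseShiftFuel-0 f) (sym (baseShiftFuel-0 g))
  baseShiftFuel-irrelevant (suc n) (suc f) (suc g) n≤f n≤g =
    cong (λ x → suc n % M + N * x)
      (baseShiftFuel-irrelevant (suc n / M) f g (n≤1+f⇒n/M≤f (suc n) f n≤f)
                                                (n≤1+f⇒n/M≤f (suc n) g n≤g))

  baseShift-unfold : ∀ n → B n ≡ n % M + N * B (n / M)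
  baseShift-unfold zero = sym (begin
    0 % M + N * B (0 / M) ≡⟨ cong₂ (λ r q → r + N * B q) 0%M≡0 (0/n≡0 M) ⟩
    N * 0                 ≡⟨ *-zeroʳ N ⟩
    0                     ∎)
    where open ≡-Reasoning
  baseShift-unfold (suc n) = cong (λ x → suc n % M + N * x)
    (baseShiftFuel-irrelevant (suc n / M) n (suc n / M) (n≤1+f⇒n/M≤f (suc n) n ≤-refl) ≤-refl)

  baseShift-digit : ∀ {r} c → r < M → B (r + M * c) ≡ r + N * B c
  baseShift-digit {r} c r<M = trans (baseShift-unfold (r + M * c)) (cong₂ (λ x y → x + N * B y) r+Mc%M r+Mc/M)
    where
    open ≡-Reasoning
    r+Mc%M : (r + M * c) % M ≡ r
    r+Mc%M = begin
      (r + M * c) % M ≡⟨ %-remove-+ʳ r (m∣m*n c) ⟩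
      r % M           ≡⟨ m<n⇒m%n≡m r<M ⟩
      r               ∎
    r+Mc/M : (r + M * c) / M ≡ c
    r+Mc/M = begin
      (r + M * c) / M   ≡⟨ cong (λ x → (r + x) / M) (*-comm M c) ⟩
      (r + c * M) / M   ≡⟨ +-distrib-/-∣ʳ r (n∣m*n c) ⟩
      r / M + c * M / M ≡⟨ cong₂ _+_ (m<n⇒m/n≡0 r<M) (m*n/n≡m c M) ⟩
      c                 ∎

  baseShift-split : ∀ k {r} c → r < M ^ k → B (r + M ^ k * c) ≡ B r + N ^ k * B c
  baseShift-split zero    {zero} c _ = trans (cong B (+-identityʳ c)) (sym (+-identityʳ (B c)))
  baseShift-split zero    {suc r} c (s≤s ())
  baseShift-split (suc k) {r}    c r<M^1+k = begin
    B (r + M * M ^ k * c)                     ≡⟨ cong B digits ⟩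
    B (r % M + M * (r / M + M ^ k * c))       ≡⟨ baseShift-digit _ (m%n<n r M) ⟩
    r % M + N * B (r / M + M ^ k * c)         ≡⟨ cong (λ x → r % M + N * x) (baseShift-split k c r/M<M^k) ⟩
    r % M + N * (B (r / M) + N ^ k * B c)     ≡⟨ regroup (r % M) N (B (r / M)) (N ^ k) (B c) ⟩
    (r % M + N * B (r / M)) + N * N ^ k * B c ≡⟨ cong (_+ N * N ^ k * B c) (baseShift-unfold r) ⟨
    B r + N * N ^ k * B c                     ∎
    where
    open ≡-Reasoning
    r/M<M^k : r / M < M ^ k
    r/M<M^k = m<n*o⇒m/o<n (subst (r <_) (*-comm M (M ^ k)) r<M^1+k)
    digits : r + M * M ^ k * c ≡ r % M + M * (r / M + M ^ k * c)
    digits = trans (cong (_+ M * M ^ k * c) (m≡m%n+[m/n]*n r M))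
      (ring (r % M) (r / M) M (M ^ k) c)
      where
      ring : ∀ a b m t c → a + b * m + m * t * c ≡ a + m * (b + t * c)
      ring = solve-∀
    regroup : ∀ a n b t d → a + n * (b + t * d) ≡ (a + n * b) + n * t * d
    regroup = solve-∀

  baseShift-scale : ∀ k c → B (M ^ k * c) ≡ N ^ k * B c
  baseShift-scale k c = baseShift-split k c (m^n>0 M k)

  baseShift-1 : B 1 ≡ 1
  baseShift-1 = begin
    B 1           ≡⟨ cong (λ x → B (1 + x)) (*-zeroʳ M) ⟨
    B (1 + M * 0) ≡⟨ baseShift-digit 0 1<M ⟩
    1 + N * B 0   ≡⟨ cong (1 +_) (*-zeroʳ N) ⟩
    1             ∎
    where open ≡-Reasoning

  baseShift-^ : ∀ k → B (M ^ k) ≡ N ^ k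
  baseShift-^ k = begin
    B (M ^ k)     ≡⟨ cong B (*-identityʳ (M ^ k)) ⟨
    B (M ^ k * 1) ≡⟨ baseShift-scale k 1 ⟩
    N ^ k * B 1   ≡⟨ cong (N ^ k *_) baseShift-1 ⟩
    N ^ k * 1     ≡⟨ *-identityʳ (N ^ k) ⟩
    N ^ k         ∎
    where open ≡-Reasoning

  baseShift-digit+^ : ∀ k {r} → r < M → B (r + M ^ suc k) ≡ r + N ^ suc k
  baseShift-digit+^ k r<M = trans (baseShift-digit (M ^ k) r<M) (cong (λ x → _ + N * x) (baseShift-^ k))

  baseShift-^+^ : ∀ k → B (M ^ k + M ^ suc k) ≡ N ^ k + N ^ suc k
  baseShift-^+^ k = begin
    B (M ^ k + M * M ^ k)     ≡⟨ cong B (factor (M ^ k) M) ⟩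
    B (M ^ k * (1 + M * 1))   ≡⟨ baseShift-scale k _ ⟩
    N ^ k * B (1 + M * 1)     ≡⟨ cong (N ^ k *_) (baseShift-digit+^ 0 1<M) ⟩
    N ^ k * (1 + N * 1)       ≡⟨ factor (N ^ k) N ⟨
    N ^ k + N * N ^ k         ∎
    where
    open ≡-Reasoning
    factor : ∀ x m → x + m * x ≡ x * (1 + m * 1)
    factor = solve-∀

  baseShift-dropHighDigits : ∀ k → M ∣ N ^ k → ∀ {r} q → r < M ^ k → B (r + M ^ k * q) ≋ B r
  baseShift-dropHighDigits k M∣Nᵏ q r<Mᵏ =
    trans (cong (_% M) (baseShift-split k q r<Mᵏ)) (%-remove-+ʳ _ (∣-trans M∣Nᵏ (m∣m*n _)))

  ∣^⇒ultimatelyPeriodic : ∃[ k ] M ∣ N ^ k → UltimatelyPeriodic (bSeq M N)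
  ∣^⇒ultimatelyPeriodic (k , M∣Nᵏ) = M ^ k , 0 , m^n>0 M k , λ n _ → begin
    B (n + M ^ k) % M                           ≡⟨ cong (λ x → B x % M) (n+Mᵏ≡r+Mᵏ[1+q] n) ⟩
    B (n % M ^ k + M ^ k * suc (n / M ^ k)) % M ≡⟨ baseShift-dropHighDigits k M∣Nᵏ _ (m%n<n n (M ^ k)) ⟩
    B (n % M ^ k) % M                           ≡⟨ baseShift-dropHighDigits k M∣Nᵏ _ (m%n<n n (M ^ k)) ⟨
    B (n % M ^ k + M ^ k * (n / M ^ k)) % M     ≡⟨ cong (λ x → B x % M) (n≡r+Mᵏq n) ⟨
    B n % M                                     ∎
    where
    open ≡-Reasoning
    instance _ = m^n≢0 M k
    n≡r+Mᵏq : ∀ n → n ≡ n % M ^ k + M ^ k * (n / M ^ k)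
    n≡r+Mᵏq n = trans (m≡m%n+[m/n]*n n (M ^ k)) (cong (n % M ^ k +_) (*-comm (n / M ^ k) (M ^ k)))
    n+Mᵏ≡r+Mᵏ[1+q] : ∀ n → n + M ^ k ≡ n % M ^ k + M ^ k * suc (n / M ^ k)
    n+Mᵏ≡r+Mᵏ[1+q] n = trans (cong (_+ M ^ k) (n≡r+Mᵏq n)) (ring (n % M ^ k) (M ^ k) (n / M ^ k))
      where
      ring : ∀ r t q → r + t * q + t ≡ r + t * suc q
      ring = solve-∀

  shift-congruence : ∀ {n₀} a u → n₀ ≤ a →
                     (∀ s → n₀ ≤ s → B (s + M ^ (a + u)) ≋ B (s + M ^ a)) →
                     ∀ y → 0 < y → N ^ a * B (y + M ^ u) ≋ N ^ a * B (y + 1)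
  shift-congruence {n₀} a u n₀≤a shift y 0<y = begin
    N ^ a * B (y + M ^ u) % M       ≡⟨ cong (_% M) (baseShift-scale a _) ⟨
    B (M ^ a * (y + M ^ u)) % M     ≡⟨ cong (λ x → B x % M) far ⟨
    B (s + M ^ (a + u)) % M         ≡⟨ shift s n₀≤s ⟩
    B (s + M ^ a) % M               ≡⟨ cong (λ x → B x % M) near ⟩
    B (M ^ a * (y + 1)) % M         ≡⟨ cong (_% M) (baseShift-scale a _) ⟩
    N ^ a * B (y + 1) % M           ∎
    where
    open ≡-Reasoning
    instance _ = >-nonZero 0<y
    s = M ^ a * y
    n₀≤s : n₀ ≤ s
    n₀≤s = ≤-trans n₀≤a (≤-trans (<⇒≤ (n<m^n 1<M a)) (m≤m*n (M ^ a) y))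
    far : s + M ^ (a + u) ≡ M ^ a * (y + M ^ u)
    far = trans (cong (s +_) (^-distribˡ-+-* M a u)) (sym (*-distribˡ-+ (M ^ a) y (M ^ u)))
    near : s + M ^ a ≡ M ^ a * (y + 1)
    near = trans (cong (s +_) (sym (*-identityʳ (M ^ a)))) (sym (*-distribˡ-+ (M ^ a) y 1))

  module _ {a t : ℕ}
           (congruence : ∀ y → 0 < y → N ^ a * B (y + M ^ suc t) ≋ N ^ a * B (y + 1)) where

    private
      A = N ^ a
      u = suc t
      p = pred M

      p<M : p < M
      p<M = subst (p <_) (suc-pred M) ≤-refl

    -- y = Mᵘ⁺¹ : the common top digit cancels, leaving Nᵘ against 1.
    N^a*N^u≋N^a : A * N ^ u ≋ A * 1
    N^a*N^u≋N^a = ≋-+-cancelʳ _ _ (A * N ^ suc u) (≋-resp lhs rhs (congruence (M ^ suc u) (m^n>0 M (suc u))))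
      where
      open ≡-Reasoning
      lhs : A * B (M ^ suc u + M ^ u) ≡ A * N ^ u + A * N ^ suc u
      lhs = begin
        A * B (M ^ suc u + M ^ u)   ≡⟨ cong (λ x → A * B x) (+-comm (M ^ suc u) (M ^ u)) ⟩
        A * B (M ^ u + M ^ suc u)   ≡⟨ cong (A *_) (baseShift-^+^ u) ⟩
        A * (N ^ u + N ^ suc u)     ≡⟨ *-distribˡ-+ A _ _ ⟩
        A * N ^ u + A * N ^ suc u   ∎
      rhs : A * B (M ^ suc u + 1) ≡ A * 1 + A * N ^ suc u
      rhs = begin
        A * B (M ^ suc u + 1)       ≡⟨ cong (λ x → A * B x) (+-comm (M ^ suc u) 1) ⟩
        A * B (1 + M ^ suc u)       ≡⟨ cong (A *_) (baseShift-digit+^ u 1<M) ⟩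
        A * (1 + N ^ suc u)         ≡⟨ *-distribˡ-+ A 1 _ ⟩
        A * 1 + A * N ^ suc u       ∎

    -- y = pred M + Mᵘ⁺¹ : adding 1 carries into the next digit, adding Mᵘ does not.
    N^a*p+N^a*N^u≋N^a*N : A * p + A * N ^ u ≋ A * N
    N^a*p+N^a*N^u≋N^a*N = ≋-+-cancelʳ _ _ (A * N ^ suc u) (≋-resp lhs rhs (congruence (p + M ^ suc u) y>0))
      where
      open ≡-Reasoning
      y>0 : 0 < p + M ^ suc u
      y>0 = ≤-trans (m^n>0 M (suc u)) (m≤n+m _ p)
      lhs : A * B (p + M ^ suc u + M ^ u) ≡ A * p + A * N ^ u + A * N ^ suc u
      lhs = begin
        A * B (p + M ^ suc u + M ^ u)            ≡⟨ cong (λ x → A * B x) (digits p M (M ^ t)) ⟩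
        A * B (p + M * (M ^ t + M ^ suc t))      ≡⟨ cong (A *_) (baseShift-digit _ p<M) ⟩
        A * (p + N * B (M ^ t + M ^ suc t))      ≡⟨ cong (λ x → A * (p + N * x)) (baseShift-^+^ t) ⟩
        A * (p + N * (N ^ t + N ^ suc t))        ≡⟨ expand A p N (N ^ t) ⟩
        A * p + A * N ^ u + A * N ^ suc u        ∎
        where
        digits : ∀ p m l → p + m * (m * l) + m * l ≡ p + m * (l + m * l)
        digits = solve-∀
        expand : ∀ a p n l → a * (p + n * (l + n * l)) ≡ a * p + a * (n * l) + a * (n * (n * l))
        expand = solve-∀
      rhs : A * B (p + M ^ suc u + 1) ≡ A * N + A * N ^ suc u
      rhs = begin
        A * B (p + M ^ suc u + 1)       ≡⟨ cong (λ x → A * B x) (carry p (M ^ suc u)) ⟩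
        A * B (suc p + M ^ suc u)       ≡⟨ cong (λ m → A * B (m + M ^ suc u)) (suc-pred M) ⟩
        A * B (M + M * M ^ u)           ≡⟨ cong (λ x → A * B x) (factor M (M ^ u)) ⟩
        A * B (0 + M * (1 + M ^ u))     ≡⟨ cong (A *_) (baseShift-digit _ (>-nonZero⁻¹ M)) ⟩
        A * (N * B (1 + M ^ suc t))     ≡⟨ cong (λ x → A * (N * x)) (baseShift-digit+^ t 1<M) ⟩
        A * (N * (1 + N ^ u))           ≡⟨ expand A N (N ^ u) ⟩
        A * N + A * N ^ suc u           ∎
        where
        carry : ∀ p x → p + x + 1 ≡ suc p + x
        carry = solve-∀
        factor : ∀ m x → m + m * x ≡ 0 + m * (1 + x)
        factor = solve-∀
        expand : ∀ a n x → a * (n * (1 + x)) ≡ a * n + a * (n * x)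
        expand = solve-∀

    ∣N^[1+a] : M ∣ N ^ suc a
    ∣N^[1+a] = subst (M ∣_) (*-comm A N) (m%n≡0⇒n∣m (A * N) M (begin
      A * N % M               ≡⟨ N^a*p+N^a*N^u≋N^a*N ⟨
      (A * p + A * N ^ u) % M ≡⟨ ≋-+-congˡ (A * p) N^a*N^u≋N^a ⟩
      (A * p + A * 1) % M     ≡⟨ cong (_% M) A*p+A*1≡A*M ⟩
      A * M % M               ≡⟨ m*n%n≡0 A M ⟩
      0                       ∎))
      where
      open ≡-Reasoning
      A*p+A*1≡A*M : A * p + A * 1 ≡ A * M
      A*p+A*1≡A*M = trans (sym (*-distribˡ-+ A p 1)) (cong (A *_) (trans (+-comm p 1) (suc-pred M)))

  ultimatelyPeriodic⇒∣^ : UltimatelyPeriodic (bSeq M N) → ∃[ k ] M ∣ N ^ k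
  ultimatelyPeriodic⇒∣^ (P , n₀ , P>0 , period)
    with a , t , n₀≤a , Mᵃ⁺ᵗ⁺¹≡Mᵃ ← %-collision P ⦃ >-nonZero P>0 ⦄ (M ^_) n₀ =
    suc a , ∣N^[1+a] {a} {t} (shift-congruence a (suc t) n₀≤a shift)
    where
    instance _ = >-nonZero P>0
    shift : ∀ s → n₀ ≤ s → B (s + M ^ (a + suc t)) ≋ B (s + M ^ a)
    shift = Periodic.period-% period _ _ Mᵃ⁺ᵗ⁺¹≡Mᵃ

prime∣^⇒∣ : ∀ {p n} → Prime p → ∀ k → p ∣ n ^ k → p ∣ n
prime∣^⇒∣ p-prime zero    p∣1 = ⊥-elim (¬prime[1] (subst Prime (∣1⇒≡1 p∣1) p-prime))
prime∣^⇒∣ {n = n} p-prime (suc k) p∣nⁿ⁺¹ with euclidsLemma n (n ^ k) p-prime p∣nⁿ⁺¹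
... | inj₁ p∣n  = p∣n
... | inj₂ p∣nᵏ = prime∣^⇒∣ p-prime k p∣nᵏ

product-∣^length : ∀ {n} ps → All Prime ps → (∀ p → Prime p → p ∣ product ps → p ∣ n) →
                   product ps ∣ n ^ length ps
product-∣^length []       []               _   = ∣-refl
product-∣^length (p ∷ ps) (p-prime ∷ primes) rad =
  *-pres-∣ (rad p p-prime (m∣m*n _)) (product-∣^length ps primes (λ q q-prime q∣ → rad q q-prime (∣n⇒∣m*n p q∣)))

primeFactors⊆⇒∣^ : ∀ {m n} .{{_ : NonZero m}} → (∀ p → Prime p → p ∣ m → p ∣ n) → ∃[ k ] m ∣ n ^ k
primeFactors⊆⇒∣^ {m} {n} rad =
  length F.factors , subst (_∣ n ^ length F.factors) (sym F.isFactorisation) (product-∣^length F.factors F.factorsPrime rad′)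
  where
  module F = PrimeFactorisation (factorise m)
  rad′ : ∀ p → Prime p → p ∣ product F.factors → p ∣ n
  rad′ p p-prime p∣∏ = rad p p-prime (subst (p ∣_) (sym F.isFactorisation) p∣∏)

theorem2p1 : (M N : ℕ) → .{{_ : NonZero M}} → M ≥ 2 → N ≥ 1 →
    (UltimatelyPeriodic (bSeq M N) ⇔ (∀ p → Prime p → p ∣ M → p ∣ N))
theorem2p1 M N M≥2 _ = mk⇔
  (λ periodic p p-prime p∣M →
    let k , M∣Nᵏ = ultimatelyPeriodic⇒∣^ periodic in prime∣^⇒∣ p-prime k (∣-trans p∣M M∣Nᵏ))
  (λ rad → ∣^⇒ultimatelyPeriodic (primeFactors⊆⇒∣^ rad))
  where open BaseShift M N M≥2
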